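{- For a composition $\lambda=(\lambda_1,\dots,\lambda_k)$ of $n$, the length of the poset $C_\lambda$ (with the restriction of the Bruhat-Chevalley order of $S_n$) is equal to $$\binom{n-1}{2}+k-1-\sum_{r=1}^{k}(r-1)\lambda_r.$$
   Context: $S_n$ is the symmetric group on $[n]$. The standard cyclic form of $\pi\in S_n$ is its expression as a product of disjoint cycles, with cycles of length one NOT omitted, each cycle beginning with its smallest entry, and cycles ordered by increasing first entries; the composition type of $\pi$ is the sequence of cycle lengths in this order. $\Omega:S_n\to S_n$ sends $\pi$ to the permutation whose one-line notation is the word obtained by deleting the parentheses from the standard cyclic form of $\pi$. For $\lambda\vDash n$, $C_\lambda:=\Omega(A_\lambda)$ where $A_\lambda$ is the set of permutations of composition type $\lambda$. The Bruhat-Chevalley order on $S_n$ is the transitive closure of $x<y$ where $y$ is obtained from $x$ by swapping two entries $a_i<a_j$ at positions $i<j$ with $inv(y)=inv(x)+1$, where $inv(x)=|\{(i,j):i<j,\ x(i)>x(j)\}|$. $C_\lambda$ is a graded poset with a minimum and a maximum; its length is the length of its maximal chains (equivalently, the number of inversions of its maximum element). -}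

module Defs where

open import Data.Nat as ℕ using (ℕ; zero; suc; _+_; _*_; _∸_; _≤_)
open import Data.Fin as Fin using (Fin; _<?_; _<_)
open import Data.Fin.Permutation using (Permutation′; _⟨$⟩ʳ_)
open import Data.List using (List; []; _∷_; _++_; [_]; map; length; filter; allFin; tabulate; concatMap)
open import Data.Nat.ListAction using (sum)
open import Data.List.Relation.Unary.All using (All)
open import Data.List.Relation.Unary.Linked using (Linked)
open import Data.List.Relation.Binary.Permutation.Propositional using (_↭_)
open import Data.Product using (Σ; ∃; ∃-syntax; _×_; _,_; proj₁; proj₂)
open import Relation.Nullary.Decidable using (_×-dec_; yes; no)
open import Relation.Binary.PropositionalEquality using (_≡_)
open import Relation.Binary.Construct.Closure.Transitive using (TransClosure)

-- A cycle written as (first entry , remaining entries), i.e. the cycle (a r₁ … rₘ).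
Cycle : ℕ → Set
Cycle n = Fin n × List (Fin n)

cycleWord : ∀ {n} → Cycle n → List (Fin n)
cycleWord (a , r) = a ∷ r

-- cs is THE standard cyclic form of π (it is unique when it exists):
--  * fixed points included, every element of [n] occurs exactly once overall,
--  * each cycle begins with its smallest entry,
--  * cycles ordered by increasing first entries,
--  * π sends each entry of a cycle to the next one, the last to the first.
record IsStdCyclicForm {n : ℕ} (π : Permutation′ n) (cs : List (Cycle n)) : Set where
  field
    covers     : concatMap cycleWord cs ↭ allFin n
    minFirst   : All (λ c → All (λ x → proj₁ c < x) (proj₂ c)) cs
    increasing : Linked _<_ (map proj₁ cs)
    action     : All (λ c → map (π ⟨$⟩ʳ_) (cycleWord c) ≡ proj₂ c ++ [ proj₁ c ]) cs

compositionType : ∀ {n} → List (Cycle n) → List ℕ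
compositionType = map (λ c → length (cycleWord c))

OneLine : ℕ → Set
OneLine n = Fin n → Fin n

-- Ω(π): word obtained by deleting parentheses from the standard cyclic form
-- w ∈ C_λ  iff  w = Ω(π) for some π of composition type λ
Cλ : (n : ℕ) → List ℕ → OneLine n → Set
Cλ n λs w = ∃[ π ] ∃[ cs ] (IsStdCyclicForm π cs × compositionType cs ≡ λs
                              × tabulate w ≡ concatMap cycleWord cs)

inv : ∀ {n} → OneLine n → ℕ
inv {n} w = sum (map (λ i → length (filter (λ j → (i <? j) ×-dec (w j <? w i)) (allFin n))) (allFin n))

swapAt : ∀ {n} → Fin n → Fin n → OneLine n → OneLine n
swapAt {n} i j w k with k Fin.≟ i | k Fin.≟ j
... | yes _ | _ = w j
... | no _ | yes _ = w i
... | no _ | no _ = w k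

BruhatStep : ∀ {n} → OneLine n → OneLine n → Set
BruhatStep {n} x y = ∃[ i ] ∃[ j ] (i < j × x i < x j
                      × (∀ k → y k ≡ swapAt i j x k) × inv y ≡ suc (inv x))

_<B_ : ∀ {n} → OneLine n → OneLine n → Set
_<B_ = TransClosure BruhatStep

-- the length of a (sub)poset P of (A , _<_): maximal number of strict steps in a chain
-- of elements of P; i.e. there is a chain with m steps and no chain has more.
record HasLength {A : Set} (P : A → Set) (_≺_ : A → A → Set) (m : ℕ) : Set where
  field
    witness : ∃[ xs ] (All P xs × Linked _≺_ xs × length xs ≡ suc m)
    bound   : ∀ xs → All P xs → Linked _≺_ xs → length xs ≤ suc m

-- Σ_{r=1}^{k} (r-1) λ_r, computed as weighted r₀ λ = Σ (r₀ + r - 1) λ_r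
weighted : ℕ → List ℕ → ℕ
weighted r [] = 0
weighted r (x ∷ xs) = r * x + weighted (suc r) xs

module Submission where

-- Positions are 0, …, n − 1, and t is a start if t = λ₁ + ⋯ + λᵣ for some r < k. Reading the standard
-- cyclic form off w = Ω(π) shows that w ∈ C_λ iff w p < w q whenever p is a start and p < q: the starts
-- carry the cycle minima, and these increase. Conversely such a w is Ω(ρσρ⁻¹), where ρ has one-line
-- notation w and σ rotates every block of consecutive positions.
-- Counting inversions by their left end, a start begins none and any other position p at most n − 1 − p,
-- so inv ≤ F := Σ_{p not a start} (n − 1 − p) on C_λ, and since a Bruhat cover raises inv by one, no
-- chain is longer than F. Conversely, starting from the identity, as long as some non-start p has a larger
-- entry to its right, swap w p with the least such entry: no entry right of p lies strictly between the
-- two, so this is a cover, and starts stay below their suffixes. The process ends only when inv = F.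
-- Summing F block by block gives the formula.

open import Data.Bool as Bool using (Bool; true; false; if_then_else_)
open import Data.Bool.Properties using (T-≡)
open import Data.Fin as Fin using (Fin; toℕ; _<_; _≤_; _<?_; _≟_)
import Data.Fin.Properties as FinP
import Data.Fin.Permutation as Perm
open import Data.Fin.Permutation
  using (Permutation′; _⟨$⟩ʳ_; _⟨$⟩ˡ_; inverseˡ; inverseʳ; transpose; _∘ₚ_; permutation; flip)
import Data.Fin.Permutation.Components as PC
open import Data.Integer as ℤ using (1ℤ)
open import Data.Integer.Tactic.RingSolver renaming (solve-∀ to ℤ-solve-∀)
open import Data.List
  using (List; []; _∷_; _++_; [_]; map; length; filter; allFin; tabulate; take; drop; concatMap; applyUpTo)
open import Data.List.Properties
  using ( filter-all; filter-none; filter-≐; map-tabulate; length-tabulate; map-cong-local; length-take; length-drop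
        ; take++drop≡id; take-map; drop-map; tabulate-cong; map-∘; map-cong; map-injective; ∷-injective; length-++
        ; ++-assoc; map-++; length-map )
open import Data.List.Membership.Propositional using (_∈_)
open import Data.List.Membership.Propositional.Properties using (∈-allFin; ∈-tabulate⁺; ∈-++⁻; ∈-map⁺)
open import Data.List.Membership.Propositional.Properties.WithK using (unique∧set⇒bag)
open import Data.List.Relation.Binary.BagAndSetEquality using (∼bag⇒↭)
open import Data.List.Relation.Binary.Permutation.Propositional using (_↭_)
open import Data.List.Relation.Binary.Permutation.Propositional.Properties using (↭-length; filter-↭)
open import Data.List.Relation.Binary.Sublist.Propositional using (⊆-refl)
open import Data.List.Relation.Binary.Sublist.Propositional.Properties using (filter⁺; length-mono-≤)
open import Data.List.Relation.Unary.All as All using (All; []; _∷_)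
import Data.List.Relation.Unary.All.Properties as AllP
open import Data.List.Relation.Unary.AllPairs using ([]; _∷_)
open import Data.List.Relation.Unary.Any using (here; there)
open import Data.List.Relation.Unary.Linked as Linked using (Linked; []; [-]; _∷_)
open import Data.List.Relation.Unary.Linked.Properties using (Linked⇒All)
open import Data.List.Relation.Unary.Unique.Propositional using (Unique)
open import Data.List.Relation.Unary.Unique.Propositional.Properties using (allFin⁺; tabulate⁺)
open import Data.Nat as ℕ using (ℕ; zero; suc; pred; _+_; _*_; _∸_; z≤n; s≤s; _<ᵇ_)
import Data.Nat.Properties as ℕP
open import Data.Nat.Combinatorics using (_C_; nCk+nC[k+1]≡[n+1]C[k+1]; nC1≡n)
open import Data.Nat.ListAction using (sum)
open import Data.Nat.Tactic.RingSolver using (solve-∀)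
open import Data.Product as Product using (Σ; ∃; _×_; _,_; proj₁; proj₂; uncurry)
open import Data.Sum using (inj₁; inj₂)
open import Function using (_∘_; _⇔_; Equivalence; mk⇔; case_of_)
open import Function.Definitions using (Injective)
open import Level using (0ℓ)
open import Relation.Binary using (tri<; tri≈; tri>)
import Relation.Binary.Construct.Closure.Transitive as TransClosure
open import Relation.Binary.PropositionalEquality hiding ([_])
open import Relation.Nullary using (¬_; Dec; yes; no; contradiction)
open import Relation.Nullary.Decidable using (_×-dec_; ¬?; dec-true; dec-false; decidable-stable)
open import Relation.Unary using (Pred; Decidable; _⊆_; _≐_; ∁)

open import Defs

module _ {A : Set} {P : Pred A 0ℓ} (P? : Decidable P) where

  count : List A → ℕ
  count xs = length (filter P? xs)

  count-all : ∀ {xs} → All P xs → count xs ≡ length xs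
  count-all = cong length ∘ filter-all P?

  count-none : ∀ {xs} → All (∁ P) xs → count xs ≡ 0
  count-none = cong length ∘ filter-none P?

  count-↭ : ∀ {xs ys} → xs ↭ ys → count xs ≡ count ys
  count-↭ = ↭-length ∘ filter-↭ P?

count-map : ∀ {A B : Set} {P : Pred A 0ℓ} (P? : Decidable P) (f : B → A) xs →
            count P? (map f xs) ≡ count (P? ∘ f) xs
count-map P? f [] = refl
count-map P? f (x ∷ xs) with P? (f x)
... | yes _ = cong suc (count-map P? f xs)
... | no _ = count-map P? f xs

module _ {A : Set} {P Q : Pred A 0ℓ} (P? : Decidable P) (Q? : Decidable Q) where

  count-mono : P ⊆ Q → ∀ xs → count P? xs ℕ.≤ count Q? xs
  count-mono P⊆Q xs = length-mono-≤ (filter⁺ P? Q? (λ { refl → P⊆Q }) (⊆-refl {x = xs}))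

  count-cong : P ≐ Q → ∀ xs → count P? xs ≡ count Q? xs
  count-cong P≐Q = cong length ∘ filter-≐ P? Q? P≐Q

  count-agree : ∀ {xs} → All (λ x → P x ⇔ Q x) xs → count P? xs ≡ count Q? xs
  count-agree [] = refl
  count-agree {x ∷ _} (Px⇔Qx ∷ rest) with P? x | Q? x
  ... | yes _ | yes _ = cong suc (count-agree rest)
  ... | no _ | no _ = count-agree rest
  ... | yes p | no ¬q = contradiction (Equivalence.to Px⇔Qx p) ¬q
  ... | no ¬p | yes q = contradiction (Equivalence.from Px⇔Qx q) ¬p

  count-insert : ∀ {xs j} → Unique xs → j ∈ xs → ¬ P j → Q j → (∀ x → x ≢ j → P x ⇔ Q x) →
                 count Q? xs ≡ suc (count P? xs)
  count-insert {j ∷ xs} (j∉xs ∷ _) (here refl) ¬Pj Qj agree with P? j | Q? j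
  ... | yes Pj | _ = contradiction Pj ¬Pj
  ... | no _ | no ¬Qj = contradiction Qj ¬Qj
  ... | no _ | yes _ = cong suc (sym (count-agree (All.map (λ j≢x → agree _ (j≢x ∘ sym)) j∉xs)))
  count-insert {x ∷ xs} (x∉xs ∷ u) (there j∈xs) ¬Pj Qj agree with P? x | Q? x
  ... | yes _ | yes _ = cong suc (count-insert u j∈xs ¬Pj Qj agree)
  ... | no _ | no _ = count-insert u j∈xs ¬Pj Qj agree
  ... | yes p | no ¬q = contradiction (Equivalence.to (agree x (All.lookup x∉xs j∈xs)) p) ¬q
  ... | no ¬p | yes q = contradiction (Equivalence.from (agree x (All.lookup x∉xs j∈xs)) q) ¬p

sum-insert : ∀ {A : Set} (f g : A → ℕ) {xs j} → Unique xs → j ∈ xs →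
             f j ≡ suc (g j) → (∀ x → x ≢ j → f x ≡ g x) →
             sum (map f xs) ≡ suc (sum (map g xs))
sum-insert f g {j ∷ xs} (j∉xs ∷ _) (here refl) fj agree
  rewrite fj | map-cong-local (All.map (λ j≢x → agree _ (j≢x ∘ sym)) j∉xs) = refl
sum-insert f g {x ∷ xs} (x∉xs ∷ u) (there j∈xs) fj agree
  rewrite agree x (All.lookup x∉xs j∈xs) | sum-insert f g u j∈xs fj agree = ℕP.+-suc (g x) _

sum-map-mono : ∀ {A : Set} {f g : A → ℕ} → (∀ x → f x ℕ.≤ g x) →
               ∀ xs → sum (map f xs) ℕ.≤ sum (map g xs)
sum-map-mono f≤g [] = z≤n
sum-map-mono f≤g (x ∷ xs) = ℕP.+-mono-≤ (f≤g x) (sum-map-mono f≤g xs)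

sum-map-zero : ∀ {A : Set} {f : A → ℕ} → (∀ x → f x ≡ 0) → ∀ xs → sum (map f xs) ≡ 0
sum-map-zero f≗0 [] = refl
sum-map-zero f≗0 (x ∷ xs) rewrite f≗0 x = sum-map-zero f≗0 xs

All-allFin : ∀ {N} {P : Pred (Fin N) 0ℓ} → (∀ i → P i) → All P (allFin N)
All-allFin = AllP.tabulate⁺

count-greater : ∀ {N} (i : Fin N) → count (i <?_) (allFin N) ≡ N ∸ suc (toℕ i)
count-greater {suc N} Fin.zero =
  trans (count-all (Fin.zero {N} <?_) (AllP.tabulate⁺ {f = Fin.suc {N}} λ _ → s≤s z≤n))
        (length-tabulate {n = N} Fin.suc)
count-greater {suc N} (Fin.suc i) = begin
  count (Fin.suc i <?_) (tabulate (Fin.suc {N}))     ≡⟨ cong (count _) (map-tabulate {n = N} (λ k → k) Fin.suc) ⟨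
  count (Fin.suc i <?_) (map Fin.suc (allFin N))     ≡⟨ count-map (Fin.suc i <?_) Fin.suc (allFin N) ⟩
  count ((Fin.suc i <?_) ∘ Fin.suc) (allFin N)       ≡⟨ count-cong _ (i <?_) (ℕP.≤-pred , s≤s) (allFin N) ⟩
  count (i <?_) (allFin N)                           ≡⟨ count-greater i ⟩
  N ∸ suc (toℕ i)                                    ∎
  where open ≡-Reasoning

least-satisfying : ∀ {N} {P : Pred (Fin N) 0ℓ} → Decidable P → ∃ P → ∃ λ v → P v × (∀ u → P u → v ≤ u)
least-satisfying {N} {P} P? (u , Pu) with FinP.¬∀⟶∃¬-smallest N (∁ P) (¬? ∘ P?) (λ ∀¬P → ∀¬P u Pu)
... | v , ¬¬Pv , below = v , decidable-stable (P? v) ¬¬Pv ,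
  λ u Pu → ℕP.≮⇒≥ λ u<v → below (Fin.fromℕ< u<v) (subst P (sym (inject-fromℕ< u<v)) Pu)
  where
  inject-fromℕ< : ∀ {u v : Fin N} (u<v : u < v) → Fin.inject (Fin.fromℕ< u<v) ≡ u
  inject-fromℕ< u<v = FinP.toℕ-injective (trans (FinP.toℕ-inject _) (FinP.toℕ-fromℕ< u<v))

permutation-injective : ∀ {N} (ρ : Permutation′ N) → Injective _≡_ _≡_ (ρ ⟨$⟩ʳ_)
permutation-injective ρ eq = trans (sym (inverseˡ ρ)) (trans (cong (ρ ⟨$⟩ˡ_) eq) (inverseˡ ρ))

tabulate-↭-allFin : ∀ {N} (ρ : Permutation′ N) → tabulate (ρ ⟨$⟩ʳ_) ↭ allFin N
tabulate-↭-allFin {N} ρ = ∼bag⇒↭ (unique∧set⇒bag (tabulate⁺ (permutation-injective ρ)) (allFin⁺ N)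
  λ {x} → mk⇔ (λ _ → ∈-allFin x)
              (λ _ → subst (_∈ tabulate (ρ ⟨$⟩ʳ_)) (inverseʳ ρ) (∈-tabulate⁺ (ρ ⟨$⟩ˡ x))))

-- Inversions

Inversion : ∀ {N} → OneLine N → Fin N → Fin N → Set
Inversion w k m = k < m × w m < w k

inversion? : ∀ {N} (w : OneLine N) (k : Fin N) → Decidable (Inversion w k)
inversion? w k m = (k <? m) ×-dec (w m <? w k)

inversionsFrom : ∀ {N} → OneLine N → Fin N → ℕ
inversionsFrom {N} w k = count (inversion? w k) (allFin N)

transpose-matchˡ : ∀ {N} (i j : Fin N) → PC.transpose i j i ≡ j
transpose-matchˡ i j rewrite dec-true (i ≟ i) refl = refl

transpose-matchʳ : ∀ {N} (i j : Fin N) → j ≢ i → PC.transpose i j j ≡ i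
transpose-matchʳ i j j≢i rewrite dec-false (j ≟ i) j≢i | dec-true (j ≟ j) refl = refl

transpose-other : ∀ {N} (i j : Fin N) {k} → k ≢ i → k ≢ j → PC.transpose i j k ≡ k
transpose-other i j {k} k≢i k≢j rewrite dec-false (k ≟ i) k≢i | dec-false (k ≟ j) k≢j = refl

swapAt≗transpose : ∀ {N} (i j : Fin N) (w : OneLine N) k → swapAt i j w k ≡ w (PC.transpose i j k)
swapAt≗transpose i j w k with k ≟ i
... | yes refl = refl
... | no _ with k ≟ j
...   | yes refl = refl
...   | no _ = refl

inv-id : ∀ {N} → inv {N} (λ i → i) ≡ 0
inv-id {N} = sum-map-zero (λ k → count-none (inversion? (λ i → i) k)
                                   (All-allFin λ m (k<m , m<k) → FinP.<-asym k<m m<k)) (allFin N)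

bruhatStep-inv : ∀ {N} {x y : OneLine N} → BruhatStep x y → inv y ≡ suc (inv x)
bruhatStep-inv (_ , _ , _ , _ , _ , inv-y) = inv-y

<B⇒inv< : ∀ {N} {x y : OneLine N} → x <B y → inv x ℕ.< inv y
<B⇒inv< TransClosure.[ step ] = ℕP.≤-reflexive (sym (bruhatStep-inv step))
<B⇒inv< (step TransClosure.∷ x<y) = ℕP.<-trans (ℕP.≤-reflexive (sym (bruhatStep-inv step))) (<B⇒inv< x<y)

chain-inv-bound : ∀ {N} {P : OneLine N → Set} {F} → (∀ w → P w → inv w ℕ.≤ F) →
                  ∀ x xs → All P (x ∷ xs) → Linked _<B_ (x ∷ xs) → inv x + length xs ℕ.≤ F
chain-inv-bound bound x [] (Px ∷ []) _ = subst (ℕ._≤ _) (sym (ℕP.+-identityʳ (inv x))) (bound x Px)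
chain-inv-bound bound x (y ∷ ys) (_ ∷ Pys) (x<y ∷ linked) = begin
  inv x + suc (length ys) ≡⟨ ℕP.+-suc (inv x) (length ys) ⟩
  suc (inv x) + length ys ≤⟨ ℕP.+-monoˡ-≤ (length ys) (<B⇒inv< x<y) ⟩
  inv y + length ys       ≤⟨ chain-inv-bound bound y ys Pys linked ⟩
  _                       ∎
  where open ℕP.≤-Reasoning

-- Block starts and swaps

-- isStartWithin a ls t decides whether the position 1 + t steps past a block head is a start, when a
-- further positions of that block follow its head.
mutual
  isStart : List ℕ → ℕ → Bool
  isStart [] t = false
  isStart (l ∷ ls) zero = true
  isStart (l ∷ ls) (suc t) = isStartWithin (pred l) ls t

  isStartWithin : ℕ → List ℕ → ℕ → Bool
  isStartWithin zero ls t = isStart ls t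
  isStartWithin (suc a) ls zero = false
  isStartWithin (suc a) ls (suc t) = isStartWithin a ls t

isStart-inside : ∀ a ls {t} → t ℕ.< a → isStart (suc a ∷ ls) (suc t) ≡ false
isStart-inside (suc a) ls {zero} _ = refl
isStart-inside (suc a) ls {suc t} (s≤s t<a) = isStart-inside a ls t<a

isStart-next : ∀ a ls t → isStart (suc a ∷ ls) (suc (a + t)) ≡ isStart ls t
isStart-next zero ls t = refl
isStart-next (suc a) ls t = isStart-next a ls t

SuffixMinAtStarts : ∀ {N} → List ℕ → OneLine N → Set
SuffixMinAtStarts λs w = ∀ p q → isStart λs (toℕ p) ≡ true → p < q → w p < w q

-- w j is the least entry larger than w i to the right of i, so no entry right of i lies strictly between
-- w i and w j, and swapping them creates exactly one new inversion.
module Transposition {N} (w : OneLine N) (w-inj : Injective _≡_ _≡_ w) {i j : Fin N} (i<j : i < j)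
                     (wi<wj : w i < w j) (next : ∀ m → i < m → w i < w m → w j ≤ w m) where

  τ : Fin N → Fin N
  τ = PC.transpose i j

  j≢i : j ≢ i
  j≢i = FinP.<⇒≢ i<j ∘ sym

  w′ : OneLine N
  w′ = w ∘ τ

  w′-i : w′ i ≡ w j
  w′-i = cong w (transpose-matchˡ i j)

  w′-j : w′ j ≡ w i
  w′-j = cong w (transpose-matchʳ i j j≢i)

  w′-other : ∀ {m} → m ≢ i → m ≢ j → w′ m ≡ w m
  w′-other m≢i m≢j = cong w (transpose-other i j m≢i m≢j)

  gap-below : ∀ {m} → i < m → w m < w j → w m < w i
  gap-below {m} i<m wm<wj = FinP.≤∧≢⇒< (ℕP.≮⇒≥ λ wi<wm → ℕP.<⇒≱ wm<wj (next m i<m wi<wm))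
                                        (FinP.<⇒≢ i<m ∘ sym ∘ w-inj)

  gap-above : ∀ {m} → i < m → m ≢ j → w i < w m → w j < w m
  gap-above {m} i<m m≢j wi<wm = FinP.≤∧≢⇒< (next m i<m wi<wm) (m≢j ∘ sym ∘ w-inj)

  after-i : ∀ {m} → i < m → m ≢ i
  after-i i<m = FinP.<⇒≢ i<m ∘ sym

  below-i⇔below-j : ∀ {m} → i < m → w m < w i ⇔ w m < w j
  below-i⇔below-j i<m = mk⇔ (λ wm<wi → FinP.<-trans wm<wi wi<wj) (gap-below i<m)

  inversion-i-agree : ∀ m → m ≢ j → Inversion w i m ⇔ Inversion w′ i m
  inversion-i-agree m m≢j = mk⇔
    (λ (i<m , wm<wi) → i<m , subst₂ _<_ (sym (w′-other (after-i i<m) m≢j)) (sym w′-i)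
                                          (Equivalence.to (below-i⇔below-j i<m) wm<wi))
    (λ (i<m , w′m<w′i) → i<m , Equivalence.from (below-i⇔below-j i<m)
                                  (subst₂ _<_ (w′-other (after-i i<m) m≢j) w′-i w′m<w′i))

  inversionsFrom-i : inversionsFrom w′ i ≡ suc (inversionsFrom w i)
  inversionsFrom-i = count-insert (inversion? w i) (inversion? w′ i) (allFin⁺ N) (∈-allFin j)
    (λ (_ , wj<wi) → FinP.<-asym wi<wj wj<wi) (i<j , subst₂ _<_ (sym w′-j) (sym w′-i) wi<wj) inversion-i-agree

  after-k⇔after-τk : ∀ {k} → k < i → ∀ m → k < m ⇔ k < τ m
  after-k⇔after-τk {k} k<i m with m ≟ i
  ... | yes refl = mk⇔ (λ _ → FinP.<-trans k<i i<j) (λ _ → k<i)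
  ... | no _ with m ≟ j
  ...   | yes refl = mk⇔ (λ _ → k<i) (λ _ → FinP.<-trans k<i i<j)
  ...   | no _ = mk⇔ (λ k<m → k<m) (λ k<m → k<m)

  -- For k < i the swap merely permutes the positions that row k counts.
  inversionsFrom-before : ∀ {k} → k < i → inversionsFrom w′ k ≡ inversionsFrom w k
  inversionsFrom-before {k} k<i = begin
    count (inversion? w′ k) (allFin N)              ≡⟨ count-cong _ _ (to , from) (allFin N) ⟩
    count (inversion? w k ∘ τ) (allFin N)           ≡⟨ count-map (inversion? w k) τ (allFin N) ⟨
    count (inversion? w k) (map τ (allFin N))       ≡⟨ cong (count _) (map-tabulate (λ m → m) τ) ⟩
    count (inversion? w k) (tabulate τ)             ≡⟨ count-↭ _ (tabulate-↭-allFin (transpose i j)) ⟩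
    count (inversion? w k) (allFin N)               ∎
    where
    open ≡-Reasoning
    w′k≡wk : w′ k ≡ w k
    w′k≡wk = w′-other (FinP.<⇒≢ k<i) (FinP.<⇒≢ (FinP.<-trans k<i i<j))
    to : ∀ {m} → Inversion w′ k m → Inversion w k (τ m)
    to {m} (k<m , w′m<w′k) = Equivalence.to (after-k⇔after-τk k<i m) k<m , subst (w′ m <_) w′k≡wk w′m<w′k
    from : ∀ {m} → Inversion w k (τ m) → Inversion w′ k m
    from {m} (k<τm , w′m<wk) =
      Equivalence.from (after-k⇔after-τk k<i m) k<τm , subst (w′ m <_) (sym w′k≡wk) w′m<wk

  order-after : ∀ {k m} → i < k → k < m → w′ m < w′ k ⇔ w m < w k
  order-after {k} {m} i<k k<m with m ≟ j
  ... | yes refl = subst₂ (λ a b → a < b ⇔ w j < w k) (sym w′-j) (sym (w′-other (after-i i<k) (FinP.<⇒≢ k<m)))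
                     (mk⇔ (gap-above i<k (FinP.<⇒≢ k<m)) (FinP.<-trans wi<wj))
  ... | no m≢j with k ≟ j
  ...   | yes refl = subst (λ a → a < w′ j ⇔ w m < w j) (sym w′m≡wm)
                       (subst (λ b → w m < b ⇔ w m < w j) (sym w′-j) (below-i⇔below-j i<m))
    where
    i<m : i < m
    i<m = FinP.<-trans i<k k<m
    w′m≡wm : w′ m ≡ w m
    w′m≡wm = w′-other (after-i i<m) m≢j
  ...   | no k≢j = subst₂ (λ a b → a < b ⇔ w m < w k)
                     (sym (w′-other (after-i (FinP.<-trans i<k k<m)) m≢j)) (sym (w′-other (after-i i<k) k≢j))
                     (mk⇔ (λ x → x) (λ x → x))

  inversionsFrom-after : ∀ {k} → i < k → inversionsFrom w′ k ≡ inversionsFrom w k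
  inversionsFrom-after i<k = count-cong _ _
    ((λ (k<m , lt) → k<m , Equivalence.to (order-after i<k k<m) lt) ,
     (λ (k<m , lt) → k<m , Equivalence.from (order-after i<k k<m) lt)) (allFin N)

  inv-transpose : inv w′ ≡ suc (inv w)
  inv-transpose = sum-insert (inversionsFrom w′) (inversionsFrom w) (allFin⁺ N) (∈-allFin i) inversionsFrom-i other
    where
    other : ∀ k → k ≢ i → inversionsFrom w′ k ≡ inversionsFrom w k
    other k k≢i with FinP.<-cmp k i
    ... | tri< k<i _ _ = inversionsFrom-before k<i
    ... | tri≈ _ k≡i _ = contradiction k≡i k≢i
    ... | tri> _ _ i<k = inversionsFrom-after i<k

  suffixMinAtStarts-transpose : ∀ λs → isStart λs (toℕ i) ≡ false →
                                SuffixMinAtStarts λs w → SuffixMinAtStarts λs w′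
  suffixMinAtStarts-transpose λs i-inner sm p q p-start p<q with p ≟ j
  ... | yes refl = subst₂ _<_ (sym w′-j) (sym (w′-other (after-i (FinP.<-trans i<j p<q)) (FinP.<⇒≢ p<q ∘ sym)))
                     (FinP.<-trans wi<wj (sm j q p-start p<q))
  ... | no p≢j = subst (_< w′ q) (sym (w′-other p≢i p≢j)) wp<w′q
    where
    p≢i : p ≢ i
    p≢i refl = case trans (sym p-start) i-inner of λ ()
    wp<wi : p < j → w p < w i
    wp<wi p<j with FinP.<-cmp p i
    ... | tri< p<i _ _ = sm p i p-start p<i
    ... | tri≈ _ p≡i _ = contradiction p≡i p≢i
    ... | tri> _ _ i<p = gap-below i<p (sm p j p-start p<j)
    wp<w′q : w p < w′ q
    wp<w′q with q ≟ i
    ... | yes refl = sm p j p-start (FinP.<-trans p<q i<j)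
    ... | no _ with q ≟ j
    ...   | yes refl = wp<wi p<q
    ...   | no _ = sm p q p-start p<q

maxInversionsFrom : List ℕ → ∀ {N} → Fin N → ℕ
maxInversionsFrom λs {N} i = if isStart λs (toℕ i) then 0 else N ∸ suc (toℕ i)

maxInv : List ℕ → ℕ → ℕ
maxInv λs N = sum (map (maxInversionsFrom λs) (allFin N))

module _ (λs : List ℕ) {N : ℕ} where

  inv-≤-maxInv : ∀ {w} → SuffixMinAtStarts λs w → inv w ℕ.≤ maxInv λs N
  inv-≤-maxInv {w} sm = sum-map-mono bound (allFin N)
    where
    bound : ∀ i → inversionsFrom w i ℕ.≤ maxInversionsFrom λs i
    bound i with isStart λs (toℕ i) in i-start
    ... | true = ℕP.≤-reflexive (count-none (inversion? w i)
                   (All-allFin λ m (i<m , wm<wi) → FinP.<-asym wm<wi (sm i m i-start i<m)))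
    ... | false = ℕP.≤-trans (count-mono (inversion? w i) (i <?_) proj₁ (allFin N))
                             (ℕP.≤-reflexive (count-greater i))

  maxInv-≤-inv : ∀ {w} → (∀ i → isStart λs (toℕ i) ≡ false → ∀ m → i < m → w m < w i) →
                 maxInv λs N ℕ.≤ inv w
  maxInv-≤-inv {w} descending = sum-map-mono bound (allFin N)
    where
    bound : ∀ i → maxInversionsFrom λs i ℕ.≤ inversionsFrom w i
    bound i with isStart λs (toℕ i) in i-start
    ... | true = z≤n
    ... | false = ℕP.≤-trans (ℕP.≤-reflexive (sym (count-greater i)))
                    (count-mono (i <?_) (inversion? w i) (λ i<m → i<m , descending i i-start _ i<m) (allFin N))

  Violation : OneLine N → Set
  Violation w = ∃ λ i → isStart λs (toℕ i) ≡ false × ∃ λ m → i < m × w i < w m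

  violation? : ∀ w → Dec (Violation w)
  violation? w =
    FinP.any? λ i → (isStart λs (toℕ i) Bool.≟ false) ×-dec FinP.any? λ m → (i <? m) ×-dec (w i <? w m)

  no-violation⇒descending : ∀ (ρ : Permutation′ N) → ¬ Violation (ρ ⟨$⟩ʳ_) →
                           ∀ i → isStart λs (toℕ i) ≡ false → ∀ m → i < m → ρ ⟨$⟩ʳ m < ρ ⟨$⟩ʳ i
  no-violation⇒descending ρ no-violation i i-inner m i<m with FinP.<-cmp (ρ ⟨$⟩ʳ m) (ρ ⟨$⟩ʳ i)
  ... | tri< wm<wi _ _ = wm<wi
  ... | tri≈ _ wm≡wi _ = contradiction (permutation-injective ρ wm≡wi) (FinP.<⇒≢ i<m ∘ sym)
  ... | tri> _ _ wi<wm = contradiction (i , i-inner , m , i<m , wi<wm) no-violation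

  violation⇒bruhatStep : ∀ (ρ : Permutation′ N) → SuffixMinAtStarts λs (ρ ⟨$⟩ʳ_) → Violation (ρ ⟨$⟩ʳ_) →
                          ∃ λ ρ′ → SuffixMinAtStarts λs (ρ′ ⟨$⟩ʳ_) × BruhatStep (ρ ⟨$⟩ʳ_) (ρ′ ⟨$⟩ʳ_)
  violation⇒bruhatStep ρ sm (i , i-inner , m , i<m , wi<wm)
    with least-satisfying (λ v → (i <? ρ ⟨$⟩ˡ v) ×-dec (ρ ⟨$⟩ʳ i <? v))
                          (ρ ⟨$⟩ʳ m , subst (i <_) (sym (inverseˡ ρ)) i<m , wi<wm)
  ... | v , (i<j , wi<v) , least =
    transpose i j ∘ₚ ρ , suffixMinAtStarts-transpose λs i-inner sm ,
    i , j , i<j , wi<wj , (λ k → sym (swapAt≗transpose i j w k)) , inv-transpose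
    where
    w : OneLine N
    w = ρ ⟨$⟩ʳ_
    w-inj : Injective _≡_ _≡_ w
    w-inj = permutation-injective ρ
    j : Fin N
    j = ρ ⟨$⟩ˡ v
    wj≡v : w j ≡ v
    wj≡v = inverseʳ ρ
    wi<wj : w i < w j
    wi<wj = subst (w i <_) (sym wj≡v) wi<v
    next : ∀ m → i < m → w i < w m → w j ≤ w m
    next m i<m wi<wm = subst (_≤ w m) (sym wj≡v) (least (w m) (subst (i <_) (sym (inverseˡ ρ)) i<m , wi<wm))
    open Transposition w w-inj i<j wi<wj next

-- Cycle forms

blocksOf : ∀ {A : Set} → List ℕ → List A → List (A × List A)
blocksOf [] xs = []
blocksOf (l ∷ ls) [] = []
blocksOf (l ∷ ls) (x ∷ xs) = (x , take (pred l) xs) ∷ blocksOf ls (drop (pred l) xs)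

module _ {A : Set} where

  length-take-prefix : ∀ a m (xs : List A) → length xs ≡ a + m → length (take a xs) ≡ a
  length-take-prefix a m xs len =
    trans (length-take a xs) (ℕP.m≤n⇒m⊓n≡m (subst (a ℕ.≤_) (sym len) (ℕP.m≤m+n a m)))

  length-drop-prefix : ∀ a m (xs : List A) → length xs ≡ a + m → length (drop a xs) ≡ m
  length-drop-prefix a m xs len = trans (length-drop a xs) (trans (cong (_∸ a) len) (ℕP.m+n∸m≡n a m))

  concatMap-blocksOf : ∀ λs (xs : List A) → All (0 ℕ.<_) λs → length xs ≡ sum λs →
                       concatMap (uncurry _∷_) (blocksOf λs xs) ≡ xs
  concatMap-blocksOf [] [] _ _ = refl
  concatMap-blocksOf (suc a ∷ ls) (x ∷ xs) (_ ∷ ls>0) len = cong (x ∷_) (begin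
    take a xs ++ concatMap (uncurry _∷_) (blocksOf ls (drop a xs))
      ≡⟨ cong (take a xs ++_)
              (concatMap-blocksOf ls (drop a xs) ls>0 (length-drop-prefix a _ xs (ℕP.suc-injective len))) ⟩
    take a xs ++ drop a xs
      ≡⟨ take++drop≡id a xs ⟩
    xs ∎)
    where open ≡-Reasoning

  lengths-blocksOf : ∀ λs (xs : List A) → All (0 ℕ.<_) λs → length xs ≡ sum λs →
                     map (length ∘ uncurry _∷_) (blocksOf λs xs) ≡ λs
  lengths-blocksOf [] [] _ _ = refl
  lengths-blocksOf (suc a ∷ ls) (x ∷ xs) (_ ∷ ls>0) len = cong₂ _∷_
    (cong suc (length-take-prefix a _ xs (ℕP.suc-injective len)))
    (lengths-blocksOf ls (drop a xs) ls>0 (length-drop-prefix a _ xs (ℕP.suc-injective len)))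

blocksOf-map : ∀ {A B : Set} (f : A → B) λs xs →
               blocksOf λs (map f xs) ≡ map (Product.map f (map f)) (blocksOf λs xs)
blocksOf-map f [] xs = refl
blocksOf-map f (l ∷ ls) [] = refl
blocksOf-map f (l ∷ ls) (x ∷ xs) rewrite take-map {f = f} (pred l) xs | drop-map {f = f} (pred l) xs =
  cong ((f x , map f (take (pred l) xs)) ∷_) (blocksOf-map f ls (drop (pred l) xs))

++-split : ∀ {A : Set} (xs ys us vs : List A) → xs ++ ys ≡ us ++ vs → length xs ℕ.≤ length us →
           ∃ λ zs → us ≡ xs ++ zs × ys ≡ zs ++ vs
++-split [] ys us vs eq _ = us , refl , eq
++-split (x ∷ xs) ys (u ∷ us) vs eq (s≤s len) with ∷-injective eq
... | refl , eq′ with ++-split xs ys us vs eq′ len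
...   | zs , refl , ys≡ = zs , refl , ys≡

module _ {A : Set} (R : A → A → Set) where

  -- SuffixMinAtStarts for a word given as a list, the form in which it is read off a cycle form.
  ListSuffixMinAtStarts : List ℕ → List A → Set
  ListSuffixMinAtStarts λs xs = ∀ X a Y → xs ≡ X ++ a ∷ Y → isStart λs (length X) ≡ true → All (R a) Y

  listSuffixMin-head : ∀ {l ls x xs} → ListSuffixMinAtStarts (l ∷ ls) (x ∷ xs) → All (R x) xs
  listSuffixMin-head lsm = lsm [] _ _ refl refl

  listSuffixMin-drop : ∀ {a ls x xs} → length (take a xs) ≡ a →
                       ListSuffixMinAtStarts (suc a ∷ ls) (x ∷ xs) → ListSuffixMinAtStarts ls (drop a xs)
  listSuffixMin-drop {a} {ls} {x} {xs} len lsm X b Y eq start = lsm (x ∷ take a xs ++ X) b Y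
    (cong (x ∷_) (begin
      xs                           ≡⟨ take++drop≡id a xs ⟨
      take a xs ++ drop a xs       ≡⟨ cong (take a xs ++_) eq ⟩
      take a xs ++ X ++ b ∷ Y      ≡⟨ ++-assoc (take a xs) X (b ∷ Y) ⟨
      (take a xs ++ X) ++ b ∷ Y    ∎))
    (begin
      isStart (suc a ∷ ls) (suc (length (take a xs ++ X)))
        ≡⟨ cong (isStart (suc a ∷ ls) ∘ suc) (length-++ (take a xs)) ⟩
      isStart (suc a ∷ ls) (suc (length (take a xs) + length X))
        ≡⟨ cong (λ n → isStart (suc a ∷ ls) (suc (n + length X))) len ⟩
      isStart (suc a ∷ ls) (suc (a + length X))
        ≡⟨ isStart-next a ls (length X) ⟩
      isStart ls (length X)
        ≡⟨ start ⟩
      true ∎)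
    where open ≡-Reasoning

  listSuffixMin-cons : ∀ {x r rest ls} → All (R x) (r ++ rest) → ListSuffixMinAtStarts ls rest →
                       ListSuffixMinAtStarts (suc (length r) ∷ ls) (x ∷ r ++ rest)
  listSuffixMin-cons x<r++rest lsm [] a Y eq _ with ∷-injective eq
  ... | refl , refl = x<r++rest
  listSuffixMin-cons {x} {r} {rest} {ls} x<r++rest lsm (y ∷ X) a Y eq start with ℕP.<-≤-connex (length X) (length r)
  ... | inj₁ X<r = case trans (sym start) (isStart-inside (length r) ls X<r) of λ ()
  ... | inj₂ r≤X with ++-split r rest X (a ∷ Y) (proj₂ (∷-injective eq)) r≤X
  ...   | X′ , refl , rest≡ = lsm X′ a Y rest≡ (trans (sym (isStart-next (length r) ls (length X′)))
                                (trans (cong (isStart (suc (length r) ∷ ls) ∘ suc) (sym (length-++ r))) start))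

  module _ (R-trans : ∀ {x y z} → R x y → R y z → R x z) where

    linked-head-below : ∀ {a hs} → Linked R (a ∷ hs) → All (R a) hs
    linked-head-below [-] = []
    linked-head-below (a<h ∷ linked) = Linked⇒All R-trans a<h linked

    below-concat : ∀ {a} (cs : List (A × List A)) → All (λ c → R a (proj₁ c)) cs →
                   All (λ c → All (R (proj₁ c)) (proj₂ c)) cs → All (R a) (concatMap (uncurry _∷_) cs)
    below-concat [] [] [] = []
    below-concat (c ∷ cs) (a<c ∷ a<cs) (c<r ∷ mins) =
      a<c ∷ AllP.++⁺ (All.map (R-trans a<c) c<r) (below-concat cs a<cs mins)

    cycles-listSuffixMin : ∀ (cs : List (A × List A)) → All (λ c → All (R (proj₁ c)) (proj₂ c)) cs →
                           Linked R (map proj₁ cs) →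
                           ListSuffixMinAtStarts (map (length ∘ uncurry _∷_) cs) (concatMap (uncurry _∷_) cs)
    cycles-listSuffixMin [] _ _ [] _ _ ()
    cycles-listSuffixMin [] _ _ (_ ∷ _) _ _ ()
    cycles-listSuffixMin ((a , r) ∷ cs) (a<r ∷ mins) heads = listSuffixMin-cons
      (AllP.++⁺ a<r (below-concat cs (AllP.map⁻ (linked-head-below heads)) mins))
      (cycles-listSuffixMin cs mins (Linked.tail heads))

  blocksOf-headsBelow : ∀ λs xs → All (0 ℕ.<_) λs → length xs ≡ sum λs → ListSuffixMinAtStarts λs xs →
                        All (λ c → All (R (proj₁ c)) (proj₂ c)) (blocksOf λs xs)
  blocksOf-headsBelow [] _ _ _ _ = []
  blocksOf-headsBelow (suc a ∷ ls) (x ∷ xs) (_ ∷ ls>0) len lsm =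
    AllP.take⁺ a (listSuffixMin-head lsm) ∷
    blocksOf-headsBelow ls (drop a xs) ls>0 (length-drop-prefix a _ xs (ℕP.suc-injective len))
      (listSuffixMin-drop (length-take-prefix a _ xs (ℕP.suc-injective len)) lsm)

  blocksOf-headsIncreasing : ∀ λs xs → All (0 ℕ.<_) λs → length xs ≡ sum λs → ListSuffixMinAtStarts λs xs →
                             Linked R (map proj₁ (blocksOf λs xs))
  blocksOf-headsIncreasing [] _ _ _ _ = []
  blocksOf-headsIncreasing (suc a ∷ ls) (x ∷ xs) (_ ∷ ls>0) len lsm =
    link (AllP.drop⁺ a (listSuffixMin-head lsm))
      (blocksOf-headsIncreasing ls (drop a xs) ls>0 (length-drop-prefix a _ xs (ℕP.suc-injective len))
        (listSuffixMin-drop (length-take-prefix a _ xs (ℕP.suc-injective len)) lsm))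
    where
    link : ∀ {ls zs} → All (R x) zs → Linked R (map proj₁ (blocksOf ls zs)) →
           Linked R (x ∷ map proj₁ (blocksOf ls zs))
    link {[]} _ _ = [-]
    link {_ ∷ _} {[]} _ _ = [-]
    link {_ ∷ _} {_ ∷ _} (x<z ∷ _) linked = x<z ∷ linked

++-cancel-equal-length : ∀ {A : Set} (xs us : List A) {ys vs} → xs ++ ys ≡ us ++ vs → length xs ≡ length us →
                         ys ≡ vs
++-cancel-equal-length [] [] eq _ = eq
++-cancel-equal-length (x ∷ xs) (u ∷ us) eq len =
  ++-cancel-equal-length xs us (proj₂ (∷-injective eq)) (ℕP.suc-injective len)

allFin-split : ∀ {N} (p : Fin N) → ∃ λ B → ∃ λ A →
               allFin N ≡ B ++ p ∷ A × length B ≡ toℕ p × All (_< p) B × All (p <_) A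
allFin-split {suc N} Fin.zero =
  [] , tabulate Fin.suc , refl , refl , [] , AllP.tabulate⁺ {f = Fin.suc {N}} λ _ → s≤s z≤n
allFin-split {suc N} (Fin.suc p) with allFin-split p
... | B , A , eq , len , B<p , p<A = Fin.zero ∷ map Fin.suc B , map Fin.suc A ,
  cong (Fin.zero ∷_) (begin
    tabulate Fin.suc                    ≡⟨ map-tabulate (λ k → k) Fin.suc ⟨
    map Fin.suc (allFin N)              ≡⟨ cong (map Fin.suc) eq ⟩
    map Fin.suc (B ++ p ∷ A)            ≡⟨ map-++ Fin.suc B (p ∷ A) ⟩
    map Fin.suc B ++ Fin.suc p ∷ map Fin.suc A ∎) ,
  cong suc (trans (length-map Fin.suc B) len) ,
  s≤s z≤n ∷ AllP.map⁺ (All.map s≤s B<p) , AllP.map⁺ (All.map s≤s p<A)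
  where open ≡-Reasoning

tabulate-split : ∀ {N} (w : OneLine N) (p : Fin N) → ∃ λ B → ∃ λ A →
                 tabulate w ≡ map w B ++ w p ∷ map w A × length B ≡ toℕ p ×
                 (∀ q → p < q → q ∈ A) × All (p <_) A
tabulate-split {N} w p with allFin-split p
... | B , A , eq , len , B<p , p<A = B , A ,
  trans (sym (map-tabulate (λ k → k) w)) (trans (cong (map w) eq) (map-++ w B (p ∷ A))) ,
  len , after , p<A
  where
  after : ∀ q → p < q → q ∈ A
  after q p<q with ∈-++⁻ B (subst (q ∈_) eq (∈-allFin q))
  ... | inj₁ q∈B = contradiction (All.lookup B<p q∈B) (FinP.<-asym p<q)
  ... | inj₂ (here refl) = contradiction p<q (FinP.<-irrefl refl)
  ... | inj₂ (there q∈A) = q∈A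

prefix<length : ∀ {N} (w : OneLine N) {X a Y} → tabulate w ≡ X ++ a ∷ Y → length X ℕ.< N
prefix<length w {X} eq = subst (length X ℕ.<_) (trans (sym (length-++ X)) (trans (cong length (sym eq)) (length-tabulate w)))
                           (ℕP.m<m+n (length X) (s≤s z≤n))

tabulate-decompose : ∀ {N} (w : OneLine N) X a Y → tabulate w ≡ X ++ a ∷ Y →
                     ∃ λ p → toℕ p ≡ length X × a ≡ w p × ∃ λ A → Y ≡ map w A × All (p <_) A
tabulate-decompose w X a Y eq with tabulate-split w (Fin.fromℕ< (prefix<length w eq))
... | B , A , eq′ , len , _ , p<A =
  _ , FinP.toℕ-fromℕ< _ , proj₁ (∷-injective a∷Y≡) , A , proj₂ (∷-injective a∷Y≡) , p<A
  where
  a∷Y≡ : a ∷ Y ≡ w (Fin.fromℕ< (prefix<length w eq)) ∷ map w A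
  a∷Y≡ = ++-cancel-equal-length X (map w B) (trans (sym eq) eq′)
           (trans (sym (FinP.toℕ-fromℕ< _)) (trans (sym len) (sym (length-map w B))))

module _ {N : ℕ} (λs : List ℕ) (w : OneLine N) where

  suffixMin⇒listSuffixMin : SuffixMinAtStarts λs w → ListSuffixMinAtStarts _<_ λs (tabulate w)
  suffixMin⇒listSuffixMin sm X a Y eq start with tabulate-decompose w X a Y eq
  ... | p , p≡X , refl , A , refl , p<A = AllP.map⁺ (All.map (sm p _ (trans (cong (isStart λs) p≡X) start)) p<A)

  listSuffixMin⇒suffixMin : ListSuffixMinAtStarts _<_ λs (tabulate w) → SuffixMinAtStarts λs w
  listSuffixMin⇒suffixMin lsm p q start p<q with tabulate-split w p
  ... | B , A , eq , len , after , _ =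
    All.lookup (lsm (map w B) (w p) (map w A) eq (trans (cong (isStart λs) (trans (length-map w B) len)) start))
               (∈-map⁺ w (after q p<q))

Cλ⇒suffixMinAtStarts : ∀ {N} λs (w : OneLine N) → Cλ N λs w → SuffixMinAtStarts λs w
Cλ⇒suffixMinAtStarts λs w (_ , cs , std , type , word) = listSuffixMin⇒suffixMin λs w
  (subst₂ (ListSuffixMinAtStarts _<_) type (sym word)
    (cycles-listSuffixMin _<_ FinP.<-trans cs (IsStdCyclicForm.minFirst std) (IsStdCyclicForm.increasing std)))

<⇒<ᵇ≡true : ∀ {m n} → m ℕ.< n → (m <ᵇ n) ≡ true
<⇒<ᵇ≡true m<n = Equivalence.to T-≡ (ℕP.<⇒<ᵇ m<n)

≥⇒<ᵇ≡false : ∀ {m n} → n ℕ.≤ m → (m <ᵇ n) ≡ false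
≥⇒<ᵇ≡false {m} {n} n≤m with m <ᵇ n in eq
... | false = refl
... | true = contradiction (ℕP.<ᵇ⇒< m n (Equivalence.from T-≡ eq)) (ℕP.≤⇒≯ n≤m)

<ᵇ≡true⇒< : ∀ {m n} → (m <ᵇ n) ≡ true → m ℕ.< n
<ᵇ≡true⇒< {m} {n} eq = ℕP.<ᵇ⇒< m n (Equivalence.from T-≡ eq)

<ᵇ≡false⇒≥ : ∀ {m n} → (m <ᵇ n) ≡ false → n ℕ.≤ m
<ᵇ≡false⇒≥ eq = ℕP.≮⇒≥ λ m<n → case trans (sym eq) (<⇒<ᵇ≡true m<n) of λ ()

-- Each position goes to the next one of its block, the last one back to the first.
rotate : List ℕ → ℕ → ℕ
rotate [] t = t
rotate (l ∷ ls) t = if t <ᵇ l then (if suc t <ᵇ l then suc t else 0) else l + rotate ls (t ∸ l)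

unrotate : List ℕ → ℕ → ℕ
unrotate [] t = t
unrotate (l ∷ ls) t = if t <ᵇ l then (if 0 <ᵇ t then pred t else pred l) else l + unrotate ls (t ∸ l)

∸-<-block : ∀ l m t → t ℕ.< l + m → l ℕ.≤ t → t ∸ l ℕ.< m
∸-<-block l m t t<l+m l≤t = ℕP.+-cancelˡ-< l _ _ (subst (ℕ._< l + m) (sym (ℕP.m+[n∸m]≡n l≤t)) t<l+m)

rotate-< : ∀ λs t → All (0 ℕ.<_) λs → t ℕ.< sum λs → rotate λs t ℕ.< sum λs
rotate-< (l ∷ ls) t (l>0 ∷ ls>0) t<sum with t <ᵇ l in t<?l
... | true with suc t <ᵇ l in t+1<?l
...   | true = ℕP.<-≤-trans (<ᵇ≡true⇒< t+1<?l) (ℕP.m≤m+n l _)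
...   | false = ℕP.<-≤-trans l>0 (ℕP.m≤m+n l _)
rotate-< (l ∷ ls) t (_ ∷ ls>0) t<sum | false =
  ℕP.+-monoʳ-< l (rotate-< ls (t ∸ l) ls>0 (∸-<-block l (sum ls) t t<sum (<ᵇ≡false⇒≥ t<?l)))

unrotate-< : ∀ λs t → All (0 ℕ.<_) λs → t ℕ.< sum λs → unrotate λs t ℕ.< sum λs
unrotate-< (suc a ∷ ls) t (_ ∷ ls>0) t<sum with t <ᵇ suc a in t<?l
... | true with 0 <ᵇ t
...   | true = ℕP.<-≤-trans (ℕP.≤-<-trans (ℕP.pred[n]≤n {t}) (<ᵇ≡true⇒< t<?l)) (ℕP.m≤m+n (suc a) _)
...   | false = ℕP.<-≤-trans (ℕP.n<1+n a) (ℕP.m≤m+n (suc a) _)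
unrotate-< (suc a ∷ ls) t (_ ∷ ls>0) t<sum | false =
  ℕP.+-monoʳ-< (suc a) (unrotate-< ls (t ∸ suc a) ls>0 (∸-<-block (suc a) (sum ls) t t<sum (<ᵇ≡false⇒≥ t<?l)))

unrotate-rotate : ∀ λs t → All (0 ℕ.<_) λs → t ℕ.< sum λs → unrotate λs (rotate λs t) ≡ t
unrotate-rotate (suc a ∷ ls) t (_ ∷ ls>0) t<sum with t <ᵇ suc a in t<?l
... | true with suc t <ᵇ suc a in t+1<?l
...   | true rewrite t+1<?l = refl
...   | false = ℕP.≤-antisym (ℕP.≤-pred (<ᵇ≡false⇒≥ t+1<?l)) (ℕP.≤-pred (<ᵇ≡true⇒< t<?l))
unrotate-rotate (suc a ∷ ls) t (_ ∷ ls>0) t<sum | false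
  rewrite ≥⇒<ᵇ≡false {suc a + rotate ls (t ∸ suc a)} {suc a} (ℕP.m≤m+n (suc a) _)
        | ℕP.m+n∸m≡n a (rotate ls (t ∸ suc a))
        | unrotate-rotate ls (t ∸ suc a) ls>0 (∸-<-block (suc a) (sum ls) t t<sum (<ᵇ≡false⇒≥ t<?l))
  = ℕP.m+[n∸m]≡n {suc a} (<ᵇ≡false⇒≥ t<?l)

rotate-unrotate : ∀ λs t → All (0 ℕ.<_) λs → t ℕ.< sum λs → rotate λs (unrotate λs t) ≡ t
rotate-unrotate (suc a ∷ ls) zero (_ ∷ _) _
  rewrite <⇒<ᵇ≡true {a} {suc a} ℕP.≤-refl | ≥⇒<ᵇ≡false {a} {a} ℕP.≤-refl = refl
rotate-unrotate (suc a ∷ ls) (suc t) (_ ∷ ls>0) t<sum with suc t <ᵇ suc a in t<?l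
... | true rewrite <⇒<ᵇ≡true {t} {suc a} (ℕP.<-trans (ℕP.n<1+n t) (<ᵇ≡true⇒< t<?l)) | t<?l = refl
... | false rewrite ≥⇒<ᵇ≡false {suc a + unrotate ls (t ∸ a)} {suc a} (ℕP.m≤m+n (suc a) _)
                  | ℕP.m+n∸m≡n a (unrotate ls (t ∸ a))
                  | rotate-unrotate ls (t ∸ a) ls>0 (∸-<-block (suc a) (sum ls) (suc t) t<sum (<ᵇ≡false⇒≥ t<?l))
  = ℕP.m+[n∸m]≡n {suc a} (<ᵇ≡false⇒≥ {suc t} {suc a} t<?l)

IsCycleOf : ∀ {A : Set} → (A → A) → A × List A → Set
IsCycleOf f c = map f (uncurry _∷_ c) ≡ proj₂ c ++ [ proj₁ c ]

consecutive : ℕ → ℕ → List ℕ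
consecutive o zero = []
consecutive o (suc c) = o ∷ consecutive (suc o) c

take-consecutive : ∀ a m o → take a (consecutive o (a + m)) ≡ consecutive o a
take-consecutive zero m o = refl
take-consecutive (suc a) m o = cong (o ∷_) (take-consecutive a m (suc o))

drop-consecutive : ∀ a m o → drop a (consecutive o (a + m)) ≡ consecutive (o + a) m
drop-consecutive zero m o = cong (λ z → consecutive z m) (sym (ℕP.+-identityʳ o))
drop-consecutive (suc a) m o = trans (drop-consecutive a m (suc o)) (cong (λ z → consecutive z m) (sym (ℕP.+-suc o a)))

tabulate-consecutive : ∀ o n → tabulate {n = n} (λ i → o + toℕ i) ≡ consecutive o n
tabulate-consecutive o zero = refl
tabulate-consecutive o (suc n) =
  cong₂ _∷_ (ℕP.+-identityʳ o) (trans (tabulate-cong (λ i → ℕP.+-suc o (toℕ i))) (tabulate-consecutive (suc o) n))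

map-consecutive-shift : ∀ (f : ℕ → ℕ) o b c →
                        (∀ i → i ℕ.< c → f (b + i) ≡ suc (b + i)) → f (b + c) ≡ o →
                        map f (b ∷ consecutive (suc b) c) ≡ consecutive (suc b) c ++ [ o ]
map-consecutive-shift f o b zero _ end = cong [_] (trans (cong f (sym (ℕP.+-identityʳ b))) end)
map-consecutive-shift f o b (suc c) up end = cong₂ _∷_
  (trans (cong f (sym (ℕP.+-identityʳ b))) (trans (up 0 (s≤s z≤n)) (cong suc (ℕP.+-identityʳ b))))
  (map-consecutive-shift f o (suc b) c
    (λ i i<c → trans (cong f (sym (ℕP.+-suc b i))) (trans (up (suc i) (s≤s i<c)) (cong suc (ℕP.+-suc b i))))
    (trans (cong f (sym (ℕP.+-suc b c))) end))

rotate-isCycleOf-blocks : ∀ λs o (f : ℕ → ℕ) → All (0 ℕ.<_) λs →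
                          (∀ t → o ℕ.≤ t → f t ≡ o + rotate λs (t ∸ o)) →
                          All (IsCycleOf f) (blocksOf λs (consecutive o (sum λs)))
rotate-isCycleOf-blocks [] o f _ _ = []
rotate-isCycleOf-blocks (suc a ∷ ls) o f (_ ∷ ls>0) f≗rotate
  rewrite take-consecutive a (sum ls) (suc o) | drop-consecutive a (sum ls) (suc o) =
  map-consecutive-shift f o o a inside last ∷
  subst (λ z → All (IsCycleOf f) (blocksOf ls (consecutive z (sum ls)))) (ℕP.+-suc o a)
        (rotate-isCycleOf-blocks ls (o + suc a) f ls>0 f≗rotate-rest)
  where
  inside : ∀ i → i ℕ.< a → f (o + i) ≡ suc (o + i)
  inside i i<a rewrite f≗rotate (o + i) (ℕP.m≤m+n o i) | ℕP.m+n∸m≡n o i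
                     | <⇒<ᵇ≡true {i} {suc a} (ℕP.<-trans i<a (ℕP.n<1+n a))
                     | <⇒<ᵇ≡true {suc i} {suc a} (s≤s i<a)
    = ℕP.+-suc o i
  last : f (o + a) ≡ o
  last rewrite f≗rotate (o + a) (ℕP.m≤m+n o a) | ℕP.m+n∸m≡n o a
             | <⇒<ᵇ≡true {a} {suc a} ℕP.≤-refl | ≥⇒<ᵇ≡false {a} {a} ℕP.≤-refl
    = ℕP.+-identityʳ o
  f≗rotate-rest : ∀ t → o + suc a ℕ.≤ t → f t ≡ (o + suc a) + rotate ls (t ∸ (o + suc a))
  f≗rotate-rest t o+a<t
    rewrite f≗rotate t (ℕP.≤-trans (ℕP.m≤m+n o (suc a)) o+a<t)
          | ≥⇒<ᵇ≡false {t ∸ o} {suc a} (ℕP.+-cancelˡ-≤ o _ _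
              (subst (o + suc a ℕ.≤_) (sym (ℕP.m+[n∸m]≡n (ℕP.≤-trans (ℕP.m≤m+n o (suc a)) o+a<t))) o+a<t))
          | ℕP.∸-+-assoc t o (suc a)
    = sym (ℕP.+-assoc o (suc a) _)

module _ {A B : Set} {f : A → A} {g : B → B} (h : A → B) (intertwines : ∀ a → g (h a) ≡ h (f a)) where

  private
    map-intertwines : ∀ xs → map g (map h xs) ≡ map h (map f xs)
    map-intertwines xs = trans (sym (map-∘ xs)) (trans (map-cong intertwines xs) (map-∘ xs))

  isCycleOf-map⁺ : ∀ {c} → IsCycleOf f c → IsCycleOf g (Product.map h (map h) c)
  isCycleOf-map⁺ {a , r} f-cycle = trans (map-intertwines (a ∷ r)) (trans (cong (map h) f-cycle) (map-++ h r [ a ]))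

  isCycleOf-map⁻ : Injective _≡_ _≡_ h → ∀ {c} → IsCycleOf g (Product.map h (map h) c) → IsCycleOf f c
  isCycleOf-map⁻ h-inj {a , r} g-cycle =
    map-injective h-inj (trans (sym (map-intertwines (a ∷ r))) (trans g-cycle (sym (map-++ h r [ a ]))))

module _ (λs : List ℕ) (λs>0 : All (0 ℕ.<_) λs) where

  rotateᶠ : Fin (sum λs) → Fin (sum λs)
  rotateᶠ i = Fin.fromℕ< (rotate-< λs (toℕ i) λs>0 (FinP.toℕ<n i))

  unrotateᶠ : Fin (sum λs) → Fin (sum λs)
  unrotateᶠ i = Fin.fromℕ< (unrotate-< λs (toℕ i) λs>0 (FinP.toℕ<n i))

  blockRotation : Permutation′ (sum λs)
  blockRotation = permutation rotateᶠ unrotateᶠ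
    (λ i → FinP.toℕ-injective (begin
      toℕ (rotateᶠ (unrotateᶠ i))     ≡⟨ FinP.toℕ-fromℕ< _ ⟩
      rotate λs (toℕ (unrotateᶠ i))   ≡⟨ cong (rotate λs) (FinP.toℕ-fromℕ< _) ⟩
      rotate λs (unrotate λs (toℕ i)) ≡⟨ rotate-unrotate λs (toℕ i) λs>0 (FinP.toℕ<n i) ⟩
      toℕ i                           ∎))
    (λ i → FinP.toℕ-injective (begin
      toℕ (unrotateᶠ (rotateᶠ i))     ≡⟨ FinP.toℕ-fromℕ< _ ⟩
      unrotate λs (toℕ (rotateᶠ i))   ≡⟨ cong (unrotate λs) (FinP.toℕ-fromℕ< _) ⟩
      unrotate λs (rotate λs (toℕ i)) ≡⟨ unrotate-rotate λs (toℕ i) λs>0 (FinP.toℕ<n i) ⟩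
      toℕ i                           ∎))
    where open ≡-Reasoning

  blockRotation-isCycleOf : All (IsCycleOf (blockRotation ⟨$⟩ʳ_)) (blocksOf λs (allFin (sum λs)))
  blockRotation-isCycleOf =
    All.map (isCycleOf-map⁻ toℕ (λ i → sym (FinP.toℕ-fromℕ< _)) FinP.toℕ-injective)
      (AllP.map⁻ (subst (All (IsCycleOf (rotate λs))) (blocksOf-map toℕ λs (allFin (sum λs)))
        (subst (λ xs → All (IsCycleOf (rotate λs)) (blocksOf λs xs)) consecutive≡
          (rotate-isCycleOf-blocks λs 0 (rotate λs) λs>0 (λ _ _ → refl)))))
    where
    consecutive≡ : consecutive 0 (sum λs) ≡ map toℕ (allFin (sum λs))
    consecutive≡ = trans (sym (tabulate-consecutive 0 (sum λs))) (sym (map-tabulate (λ i → i) toℕ))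

-- The cycles of ρσρ⁻¹, for σ the block rotation, are the blocks of the word of ρ.
suffixMinAtStarts⇒Cλ : ∀ λs → All (0 ℕ.<_) λs → (ρ : Permutation′ (sum λs)) →
                       SuffixMinAtStarts λs (ρ ⟨$⟩ʳ_) → Cλ (sum λs) λs (ρ ⟨$⟩ʳ_)
suffixMinAtStarts⇒Cλ λs λs>0 ρ sm = π , cs ,
  record
    { covers     = subst (_↭ allFin N) (sym concat≡) (tabulate-↭-allFin ρ)
    ; minFirst   = blocksOf-headsBelow _<_ λs word λs>0 length≡ lsm
    ; increasing = blocksOf-headsIncreasing _<_ λs word λs>0 length≡ lsm
    ; action     = subst (All (IsCycleOf (π ⟨$⟩ʳ_))) cs≡
                     (AllP.map⁺ (All.map (isCycleOf-map⁺ w π-conjugates) (blockRotation-isCycleOf λs λs>0)))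
    } ,
  lengths-blocksOf λs word λs>0 length≡ , sym concat≡
  where
  N : ℕ
  N = sum λs
  w : OneLine N
  w = ρ ⟨$⟩ʳ_
  word : List (Fin N)
  word = tabulate w
  cs : List (Cycle N)
  cs = blocksOf λs word
  π : Permutation′ N
  π = flip ρ ∘ₚ (blockRotation λs λs>0 ∘ₚ ρ)
  π-conjugates : ∀ i → π ⟨$⟩ʳ (w i) ≡ w (blockRotation λs λs>0 ⟨$⟩ʳ i)
  π-conjugates i = cong (λ k → ρ ⟨$⟩ʳ (blockRotation λs λs>0 ⟨$⟩ʳ k)) (inverseˡ ρ)
  length≡ : length word ≡ N
  length≡ = length-tabulate w
  concat≡ : concatMap (uncurry _∷_) cs ≡ word
  concat≡ = concatMap-blocksOf λs word λs>0 length≡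
  lsm : ListSuffixMinAtStarts _<_ λs word
  lsm = suffixMin⇒listSuffixMin λs w sm
  cs≡ : map (Product.map w (map w)) (blocksOf λs (allFin N)) ≡ cs
  cs≡ = trans (sym (blocksOf-map w λs (allFin N))) (cong (blocksOf λs) (map-tabulate (λ i → i) w))

-- Longest chains and the closed formula

module _ (λs : List ℕ) (λs>0 : All (0 ℕ.<_) λs) where

  chain-from : ∀ k (ρ : Permutation′ (sum λs)) → SuffixMinAtStarts λs (ρ ⟨$⟩ʳ_) →
               k + inv (ρ ⟨$⟩ʳ_) ≡ maxInv λs (sum λs) →
               ∃ λ ws → All (Cλ (sum λs) λs) ((ρ ⟨$⟩ʳ_) ∷ ws) × Linked _<B_ ((ρ ⟨$⟩ʳ_) ∷ ws) × length ws ≡ k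
  chain-from zero ρ sm _ = [] , suffixMinAtStarts⇒Cλ λs λs>0 ρ sm ∷ [] , [-] , refl
  chain-from (suc k) ρ sm k+inv≡max with violation? λs (ρ ⟨$⟩ʳ_)
  ... | no none = contradiction (maxInv-≤-inv λs (no-violation⇒descending λs ρ none))
                    (ℕP.<⇒≱ (subst (inv (ρ ⟨$⟩ʳ_) ℕ.<_) k+inv≡max (s≤s (ℕP.m≤n+m _ k))))
  ... | yes violation with violation⇒bruhatStep λs ρ sm violation
  ...   | ρ′ , sm′ , step
    with chain-from k ρ′ sm′ (trans (cong (k +_) (bruhatStep-inv step)) (trans (ℕP.+-suc k _) k+inv≡max))
  ...     | ws , in-Cλ , linked , len =
    (ρ′ ⟨$⟩ʳ_) ∷ ws , suffixMinAtStarts⇒Cλ λs λs>0 ρ sm ∷ in-Cλ , TransClosure.[ step ] ∷ linked , cong suc len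

Cλ-hasLength : ∀ λs → All (0 ℕ.<_) λs → HasLength (Cλ (sum λs) λs) _<B_ (maxInv λs (sum λs))
Cλ-hasLength λs λs>0 = record
  { witness = case chain-from λs λs>0 (maxInv λs (sum λs)) Perm.id (λ _ _ _ p<q → p<q) inv-id+maxInv of
      λ (ws , in-Cλ , linked , len) → _ , in-Cλ , linked , cong suc len
  ; bound   = bound
  }
  where
  inv-id+maxInv : maxInv λs (sum λs) + inv {sum λs} (λ i → i) ≡ maxInv λs (sum λs)
  inv-id+maxInv = trans (cong (maxInv λs (sum λs) +_) (inv-id {sum λs})) (ℕP.+-identityʳ _)
  bound : ∀ xs → All (Cλ (sum λs) λs) xs → Linked _<B_ xs → length xs ℕ.≤ suc (maxInv λs (sum λs))
  bound [] _ _ = z≤n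
  bound (x ∷ xs) in-Cλ linked = s≤s (ℕP.≤-trans (ℕP.m≤n+m (length xs) (inv x))
    (chain-inv-bound (λ w w∈Cλ → inv-≤-maxInv λs (Cλ⇒suffixMinAtStarts λs w w∈Cλ)) x xs in-Cλ linked))

tabulate-toℕ : ∀ n (f : ℕ → ℕ) → tabulate {n = n} (f ∘ toℕ) ≡ applyUpTo f n
tabulate-toℕ zero f = refl
tabulate-toℕ (suc n) f = cong (f 0 ∷_) (tabulate-toℕ n (f ∘ suc))

sum-applyUpTo-+ : ∀ (f : ℕ → ℕ) a b →
                  sum (applyUpTo f (a + b)) ≡ sum (applyUpTo f a) + sum (applyUpTo (f ∘ (a +_)) b)
sum-applyUpTo-+ f zero b = refl
sum-applyUpTo-+ f (suc a) b = trans (cong (f 0 +_) (sum-applyUpTo-+ (f ∘ suc) a b)) (sym (ℕP.+-assoc (f 0) _ _))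

sum-applyUpTo-cong : ∀ n {f g : ℕ → ℕ} → (∀ t → t ℕ.< n → f t ≡ g t) →
                     sum (applyUpTo f n) ≡ sum (applyUpTo g n)
sum-applyUpTo-cong zero _ = refl
sum-applyUpTo-cong (suc n) f≗g =
  cong₂ _+_ (f≗g 0 (s≤s z≤n)) (sum-applyUpTo-cong n λ t t<n → f≗g (suc t) (s≤s t<n))

C2-suc : ∀ a → suc a C 2 ≡ a + a C 2
C2-suc a = trans (sym (nCk+nC[k+1]≡[n+1]C[k+1] a 1)) (cong (_+ a C 2) (nC1≡n a))

C2-+ : ∀ a c → (a + c) C 2 ≡ a C 2 + c C 2 + a * c
C2-+ zero c = sym (ℕP.+-identityʳ (c C 2))
C2-+ (suc a) c = begin
  suc (a + c) C 2                   ≡⟨ C2-suc (a + c) ⟩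
  a + c + (a + c) C 2               ≡⟨ cong (a + c +_) (C2-+ a c) ⟩
  a + c + (a C 2 + c C 2 + a * c)   ≡⟨ rearrange a c (a C 2) (c C 2) ⟩
  (a + a C 2) + c C 2 + suc a * c   ≡⟨ cong (λ z → z + c C 2 + suc a * c) (C2-suc a) ⟨
  suc a C 2 + c C 2 + suc a * c     ∎
  where
  open ≡-Reasoning
  rearrange : ∀ a c x y → a + c + (x + y + a * c) ≡ (a + x) + y + suc a * c
  rearrange = solve-∀

sum-first-block : ∀ a m → sum (applyUpTo (λ t → m + (a ∸ suc t)) a) ≡ a * m + a C 2
sum-first-block zero m = refl
sum-first-block (suc a) m = begin
  m + a + sum (applyUpTo (λ t → m + (a ∸ suc t)) a) ≡⟨ cong (m + a +_) (sum-first-block a m) ⟩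
  m + a + (a * m + a C 2)                           ≡⟨ rearrange a m (a C 2) ⟩
  suc a * m + (a + a C 2)                           ≡⟨ cong (suc a * m +_) (C2-suc a) ⟨
  suc a * m + suc a C 2                             ∎
  where
  open ≡-Reasoning
  rearrange : ∀ a m x → m + a + (a * m + x) ≡ suc a * m + (a + x)
  rearrange = solve-∀

maxInversionsAt : List ℕ → ℕ → ℕ
maxInversionsAt λs t = if isStart λs t then 0 else sum λs ∸ suc t

maxInv′ : List ℕ → ℕ
maxInv′ λs = sum (applyUpTo (maxInversionsAt λs) (sum λs))

maxInv≡maxInv′ : ∀ λs → maxInv λs (sum λs) ≡ maxInv′ λs
maxInv≡maxInv′ λs =
  cong sum (trans (map-tabulate (λ i → i) (maxInversionsFrom λs)) (tabulate-toℕ (sum λs) (maxInversionsAt λs)))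

maxInv′-cons : ∀ a ls → maxInv′ (suc a ∷ ls) ≡ a * sum ls + a C 2 + maxInv′ ls
maxInv′-cons a ls = begin
  sum (applyUpTo (maxInversionsAt (suc a ∷ ls) ∘ suc) (a + m))
    ≡⟨ sum-applyUpTo-+ (maxInversionsAt (suc a ∷ ls) ∘ suc) a m ⟩
  sum (applyUpTo (maxInversionsAt (suc a ∷ ls) ∘ suc) a) +
  sum (applyUpTo (maxInversionsAt (suc a ∷ ls) ∘ suc ∘ (a +_)) m)
    ≡⟨ cong₂ _+_ (sum-applyUpTo-cong a inside) (sum-applyUpTo-cong m after) ⟩
  sum (applyUpTo (λ t → m + (a ∸ suc t)) a) + maxInv′ ls
    ≡⟨ cong (_+ maxInv′ ls) (sum-first-block a m) ⟩
  a * m + a C 2 + maxInv′ ls ∎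
  where
  open ≡-Reasoning
  m : ℕ
  m = sum ls
  inside : ∀ t → t ℕ.< a → maxInversionsAt (suc a ∷ ls) (suc t) ≡ m + (a ∸ suc t)
  inside t t<a rewrite isStart-inside a ls t<a = trans (ℕP.+-∸-comm m t<a) (ℕP.+-comm (a ∸ suc t) m)
  after : ∀ t → t ℕ.< m → maxInversionsAt (suc a ∷ ls) (suc (a + t)) ≡ maxInversionsAt ls t
  after t _ rewrite isStart-next a ls t | sym (ℕP.+-suc a t) | ℕP.[m+n]∸[m+o]≡n∸o a m (suc t) = refl

weighted-suc : ∀ r xs → weighted (suc r) xs ≡ weighted r xs + sum xs
weighted-suc r [] = refl
weighted-suc r (x ∷ xs) rewrite weighted-suc (suc r) xs = rearrange r x (weighted (suc r) xs) (sum xs)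
  where
  rearrange : ∀ r x W S → suc r * x + (W + S) ≡ r * x + W + (x + S)
  rearrange = solve-∀

maxInv′-closed : ∀ l ls → All (0 ℕ.<_) (l ∷ ls) →
                 maxInv′ (l ∷ ls) + 1 + weighted 0 (l ∷ ls) ≡ (sum (l ∷ ls) ∸ 1) C 2 + length (l ∷ ls)
maxInv′-closed zero _ (() ∷ _)
maxInv′-closed (suc a) (zero ∷ _) (_ ∷ () ∷ _)
maxInv′-closed (suc a) [] _ = begin
  maxInv′ (suc a ∷ []) + 1 + 0   ≡⟨ cong (λ z → z + 1 + 0) (maxInv′-cons a []) ⟩
  a * 0 + a C 2 + 0 + 1 + 0     ≡⟨ rearrange a (a C 2) ⟩
  a C 2 + 1                     ≡⟨ cong (λ z → z C 2 + 1) (ℕP.+-identityʳ a) ⟨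
  (a + 0) C 2 + 1               ∎
  where
  open ≡-Reasoning
  rearrange : ∀ a x → a * 0 + x + 0 + 1 + 0 ≡ x + 1
  rearrange = solve-∀
maxInv′-closed (suc a) (suc c ∷ ls) (_ ∷ ls>0) = begin
  maxInv′ (suc a ∷ l ∷ ls) + 1 + weighted 0 (suc a ∷ l ∷ ls)
    ≡⟨ cong₂ (λ x y → x + 1 + y) (maxInv′-cons a (l ∷ ls)) (weighted-suc 0 (l ∷ ls)) ⟩
  a * m + a C 2 + maxInv′ (l ∷ ls) + 1 + (weighted 0 (l ∷ ls) + m)
    ≡⟨ regroup a m (a C 2) (maxInv′ (l ∷ ls)) (weighted 0 (l ∷ ls)) ⟩
  (maxInv′ (l ∷ ls) + 1 + weighted 0 (l ∷ ls)) + (a * m + a C 2 + m)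
    ≡⟨ cong (_+ (a * m + a C 2 + m)) (maxInv′-closed l ls ls>0) ⟩
  (b C 2 + length (l ∷ ls)) + (a * m + a C 2 + m)
    ≡⟨ rearrange a b (a C 2) (b C 2) (length (l ∷ ls)) ⟩
  a C 2 + (b + b C 2) + a * m + suc (length (l ∷ ls))
    ≡⟨ cong (λ z → a C 2 + z + a * m + suc (length (l ∷ ls))) (C2-suc b) ⟨
  a C 2 + m C 2 + a * m + suc (length (l ∷ ls))
    ≡⟨ cong (_+ suc (length (l ∷ ls))) (C2-+ a m) ⟨
  (a + m) C 2 + suc (length (l ∷ ls)) ∎
  where
  open ≡-Reasoning
  l b m : ℕ
  l = suc c
  b = c + sum ls
  m = suc b
  regroup : ∀ a m x g w → a * m + x + g + 1 + (w + m) ≡ (g + 1 + w) + (a * m + x + m)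
  regroup = solve-∀
  rearrange : ∀ a b x y k → (y + k) + (a * suc b + x + suc b) ≡ x + (b + y) + a * suc b + suc k
  rearrange = solve-∀

maxInv-formula : ∀ l ls → All (0 ℕ.<_) (l ∷ ls) →
                 maxInv (l ∷ ls) (sum (l ∷ ls)) + 1 + weighted 0 (l ∷ ls) ≡ (sum (l ∷ ls) ∸ 1) C 2 + length (l ∷ ls)
maxInv-formula l ls λs>0 =
  trans (cong (λ F → F + 1 + weighted 0 (l ∷ ls)) (maxInv≡maxInv′ (l ∷ ls))) (maxInv′-closed l ls λs>0)

ℕ-identity⇒ℤ : ∀ m c k w → m + 1 + w ≡ c + k → ℤ.+ m ≡ ℤ.+ c ℤ.+ ℤ.+ k ℤ.- 1ℤ ℤ.- ℤ.+ w
ℕ-identity⇒ℤ m c k w eq = begin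
  ℤ.+ m                                      ≡⟨ rearrange (ℤ.+ m) (ℤ.+ w) ⟩
  ℤ.+ m ℤ.+ 1ℤ ℤ.+ ℤ.+ w ℤ.- 1ℤ ℤ.- ℤ.+ w  ≡⟨ cong (λ z → z ℤ.- 1ℤ ℤ.- ℤ.+ w) (cong ℤ.+_ eq) ⟩
  ℤ.+ (c + k) ℤ.- 1ℤ ℤ.- ℤ.+ w              ≡⟨⟩
  ℤ.+ c ℤ.+ ℤ.+ k ℤ.- 1ℤ ℤ.- ℤ.+ w          ∎
  where
  open ≡-Reasoning
  rearrange : ∀ x y → x ≡ x ℤ.+ 1ℤ ℤ.+ y ℤ.- 1ℤ ℤ.- y
  rearrange = ℤ-solve-∀

mainTheorem5 : (n : ℕ) → 0 ℕ.< n → (λs : List ℕ) → All (0 ℕ.<_) λs → sum λs ≡ n →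
    Σ ℕ (λ m → HasLength (Cλ n λs) _<B_ m
    × (ℤ.+ m ≡ ℤ.+ ((n ∸ 1) C 2) ℤ.+ ℤ.+ length λs ℤ.- 1ℤ ℤ.- ℤ.+ weighted 0 λs))
mainTheorem5 .0 () [] _ refl
mainTheorem5 _ _ (l ∷ ls) λs>0 refl = maxInv (l ∷ ls) (sum (l ∷ ls)) , Cλ-hasLength (l ∷ ls) λs>0 ,
  ℕ-identity⇒ℤ _ ((sum (l ∷ ls) ∸ 1) C 2) (length (l ∷ ls)) (weighted 0 (l ∷ ls)) (maxInv-formula l ls λs>0)
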